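{- Let $m\ge 1$ be an integer. For every integer $n\ge 0$, \[ \mathcal{F}_{m}(n,x)=\sum_{k=0}^{n}a_{m}(n,k)(1+x)^{k}x^{n-k}. \]
   Context: For a positive integer $m$, $W_{m}(n,k)=\frac{1}{m^{k}k!}\sum_{i=0}^{k}\binom{k}{i}(-1)^{k-i}(mi+1)^{n}$ are the Whitney numbers of the second kind of Dowling lattices, and the Tanny–Dowling polynomials are $\mathcal{F}_m(n,x)=\sum_{k=0}^{n}k!\,W_m(n,k)x^k$. The Eulerian–Dowling numbers are $a_m(n,k)=\sum_{i=0}^{n}(-1)^{n-i-k}\,i!\binom{n-i}{k}W_m(n,i)$ (with $\binom{a}{b}=0$ if $b>a$), so that $\sum_{k=0}^n a_m(n,k)x^k=\sum_{i=0}^n i!\,W_m(n,i)(x-1)^{n-i}$. -}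

module Defs where

open import Data.Nat as ℕ using (ℕ; zero; suc; _!; NonZero)
open import Data.Nat.Properties using (m^n≢0; m*n≢0; _!≢0)
open import Data.Nat.Combinatorics using (_C_)
open import Data.Integer as ℤ using (ℤ)
open import Data.Rational using (ℚ; 0ℚ; 1ℚ; _+_; _*_; -_; _/_)

_^ℚ_ : ℚ → ℕ → ℚ
q ^ℚ zero  = 1ℚ
q ^ℚ suc n = q * (q ^ℚ n)

ℕ→ℚ : ℕ → ℚ
ℕ→ℚ n = ℤ.+ n / 1

sumTo : ℕ → (ℕ → ℚ) → ℚ
sumTo zero    f = f 0
sumTo (suc n) f = sumTo n f + f (suc n)

sgn : ℕ → ℚ
sgn e = (- 1ℚ) ^ℚ e

-- m^k * k! is nonzero for m ≥ 1; the parameter m is given as m = suc m'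
denom-nz : (m' k : ℕ) → NonZero (suc m' ℕ.^ k ℕ.* k !)
denom-nz m' k = m*n≢0 (suc m' ℕ.^ k) (k !) {{m^n≢0 (suc m') k}} {{k !≢0}}

W : (m' n k : ℕ) → ℚ
W m' n k =
  (ℤ.+ 1 / (suc m' ℕ.^ k ℕ.* k !)) {{denom-nz m' k}}
  * sumTo k (λ i → ℕ→ℚ (k C i) * sgn (k ℕ.∸ i) * ℕ→ℚ ((suc m' ℕ.* i ℕ.+ 1) ℕ.^ n))

F : (m' n : ℕ) → ℚ → ℚ
F m' n x = sumTo n (λ k → ℕ→ℚ (k !) * W m' n k * (x ^ℚ k))

-- Eulerian–Dowling numbers
-- a_m(n,k) = Σ_{i=0}^{n} (-1)^{n-i-k} i! C(n-i,k) W_m(n,i)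
-- (C(n-i,k) = 0 when k > n-i, so the truncated subtraction in the sign is harmless)
a : (m' n k : ℕ) → ℚ
a m' n k = sumTo n (λ i → sgn (n ℕ.∸ i ℕ.∸ k) * ℕ→ℚ (i !) * ℕ→ℚ ((n ℕ.∸ i) C k) * W m' n i)

module Submission where

-- The identity has nothing to do with the Whitney numbers themselves: for ANY
-- coefficients c₀, …, cₙ and every x,
--     Σ_i c_i x^i  =  Σ_k e(n,c,k) (1+x)^k x^(n-k),
--     e(n,c,k)     =  Σ_i (-1)^(n-i-k) C(n-i,k) c_i,
-- and the theorem is the instance c_i = i! W_m(n,i), for which e(n,c,k) = a_m(n,k).
-- To see the general identity, exchange the two summations on the right: the factor
-- multiplying c_i is  Σ_k (-1)^(n-i-k) C(n-i,k) (1+x)^k x^(n-k) = x^i ((1+x) - x)^(n-i)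
-- = x^i, by the alternating binomial theorem (terms with k > n-i vanish as
-- C(n-i,k) = 0).

open import Defs
open import Data.Nat using (ℕ; suc; _∸_)
open import Data.Rational using (ℚ; _+_; _*_; 1ℚ)
open import Relation.Binary.PropositionalEquality using (_≡_)

open import Algebra.Bundles using (CommutativeRing)
open import Data.Nat as ℕ using (zero; _≤_; _<_; z≤n; s≤s)
import Data.Nat.Properties as ℕP
open import Data.Nat.Combinatorics using (_C_; k>n⇒nCk≡0)
open import Data.Fin using (toℕ)
open import Data.Integer as ℤ using ()
import Data.Integer.Properties as ℤP
open import Data.Rational using (0ℚ; -_; _-_; toℚᵘ)
open import Data.Rational.Properties
  using ( +-*-commutativeRing; +-identityʳ; +-assoc; *-identityˡ; *-identityʳ
        ; *-zeroˡ; *-distribˡ-+; *-distribʳ-+; toℚᵘ-injective; toℚᵘ-fromℚᵘ; toℚᵘ-homo-+ )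
open import Data.Rational.Solver using (module +-*-Solver)
import Data.Rational.Unnormalised as ℚᵘ
import Data.Rational.Unnormalised.Properties as ℚᵘP
open import Relation.Binary.PropositionalEquality
  using (refl; sym; trans; cong; cong₂; module ≡-Reasoning)

open CommutativeRing +-*-commutativeRing using (commutativeSemiring; semiring; +-monoid)
open import Algebra.Properties.Monoid.Sum +-monoid using (sum; sum-cong-≗)
open import Algebra.Properties.Semiring.Mult semiring using (_×_)
open import Algebra.Properties.CommutativeSemiring.Exp commutativeSemiring
  using (_^_; ^-homo-*; ^-distrib-*)
open import Algebra.Properties.CommutativeSemiring.Binomial commutativeSemiring
  using (binomialExpansion) renaming (theorem to binomialTheorem)

open +-*-Solver using (solve; _:=_; _:+_; _:*_; :-_; con)

ℕ→ℚ-suc : ∀ n → ℕ→ℚ (suc n) ≡ 1ℚ + ℕ→ℚ n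
ℕ→ℚ-suc n = toℚᵘ-injective (begin
  toℚᵘ (ℕ→ℚ (suc n))
    ≈⟨ toℚᵘ-fromℚᵘ (ℚᵘ.mkℚᵘ (ℤ.+ suc n) 0) ⟩
  ℚᵘ.mkℚᵘ (ℤ.+ suc n) 0
    ≈⟨ ℚᵘ.*≡* numerators ⟩
  ℚᵘ.1ℚᵘ ℚᵘ.+ ℚᵘ.mkℚᵘ (ℤ.+ n) 0
    ≈⟨ ℚᵘP.+-congʳ ℚᵘ.1ℚᵘ (ℚᵘP.≃-sym (toℚᵘ-fromℚᵘ (ℚᵘ.mkℚᵘ (ℤ.+ n) 0))) ⟩
  toℚᵘ 1ℚ ℚᵘ.+ toℚᵘ (ℕ→ℚ n)
    ≈⟨ ℚᵘP.≃-sym (toℚᵘ-homo-+ 1ℚ (ℕ→ℚ n)) ⟩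
  toℚᵘ (1ℚ + ℕ→ℚ n) ∎)
  where
  open ℚᵘP.≃-Reasoning
  -- all denominators are 1, so cross-multiplication only strips factors of 1
  numerators : ℤ.+ suc n ℤ.* ℤ.+ 1 ≡ (ℤ.+ 1 ℤ.* ℤ.+ 1 ℤ.+ ℤ.+ n ℤ.* ℤ.+ 1) ℤ.* ℤ.+ 1
  numerators = trans (ℤP.*-identityʳ _)
    (sym (trans (ℤP.*-identityʳ _) (cong (ℤ._+_ (ℤ.+ 1)) (ℤP.*-identityʳ (ℤ.+ n)))))

open ≡-Reasoning

^ℚ-is-^ : ∀ q n → q ^ n ≡ q ^ℚ n
^ℚ-is-^ q zero    = refl
^ℚ-is-^ q (suc n) = cong (q *_) (^ℚ-is-^ q n)

×-is-ℕ→ℚ* : ∀ n q → n × q ≡ ℕ→ℚ n * q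
×-is-ℕ→ℚ* zero    q = sym (*-zeroˡ q)
×-is-ℕ→ℚ* (suc n) q = begin
  q + n × q           ≡⟨ cong₂ _+_ (sym (*-identityˡ q)) (×-is-ℕ→ℚ* n q) ⟩
  1ℚ * q + ℕ→ℚ n * q  ≡⟨ sym (*-distribʳ-+ q 1ℚ (ℕ→ℚ n)) ⟩
  (1ℚ + ℕ→ℚ n) * q    ≡⟨ cong (_* q) (sym (ℕ→ℚ-suc n)) ⟩
  ℕ→ℚ (suc n) * q     ∎

^ℚ-+ : ∀ q a b → q ^ℚ (a ℕ.+ b) ≡ q ^ℚ a * q ^ℚ b
^ℚ-+ q a b = begin
  q ^ℚ (a ℕ.+ b)      ≡⟨ sym (^ℚ-is-^ q (a ℕ.+ b)) ⟩
  q ^ (a ℕ.+ b)       ≡⟨ ^-homo-* q a b ⟩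
  q ^ a * q ^ b       ≡⟨ cong₂ _*_ (^ℚ-is-^ q a) (^ℚ-is-^ q b) ⟩
  q ^ℚ a * q ^ℚ b     ∎

neg-^ℚ : ∀ q e → (- q) ^ℚ e ≡ sgn e * q ^ℚ e
neg-^ℚ q e = begin
  (- q) ^ℚ e          ≡⟨ sym (^ℚ-is-^ (- q) e) ⟩
  (- q) ^ e           ≡⟨ cong (_^ e) (solve 1 (λ q → :- q := (:- con 1ℚ) :* q) refl q) ⟩
  (- 1ℚ * q) ^ e      ≡⟨ ^-distrib-* (- 1ℚ) q e ⟩
  (- 1ℚ) ^ e * q ^ e  ≡⟨ cong₂ _*_ (^ℚ-is-^ (- 1ℚ) e) (^ℚ-is-^ q e) ⟩
  sgn e * q ^ℚ e      ∎

1^ℚ : ∀ e → 1ℚ ^ℚ e ≡ 1ℚ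
1^ℚ zero    = refl
1^ℚ (suc e) = trans (*-identityˡ (1ℚ ^ℚ e)) (1^ℚ e)

sumTo-cong : ∀ n {f g : ℕ → ℚ} → (∀ i → i ≤ n → f i ≡ g i) → sumTo n f ≡ sumTo n g
sumTo-cong zero    f≗g = f≗g 0 z≤n
sumTo-cong (suc n) f≗g =
  cong₂ _+_ (sumTo-cong n (λ i i≤n → f≗g i (ℕP.m≤n⇒m≤1+n i≤n))) (f≗g (suc n) ℕP.≤-refl)

sumTo-shift : ∀ n (f : ℕ → ℚ) → sumTo (suc n) f ≡ f 0 + sumTo n (λ i → f (suc i))
sumTo-shift zero    f = refl
sumTo-shift (suc n) f =
  trans (cong (_+ f (suc (suc n))) (sumTo-shift n f)) (+-assoc (f 0) _ _)

sumTo-is-∑ : ∀ n (f : ℕ → ℚ) → sumTo n f ≡ sum {suc n} (λ k → f (toℕ k))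
sumTo-is-∑ zero    f = sym (+-identityʳ (f 0))
sumTo-is-∑ (suc n) f =
  trans (sumTo-shift n f) (cong (f 0 +_) (sumTo-is-∑ n (λ i → f (suc i))))

sumTo-+ : ∀ n (f g : ℕ → ℚ) → sumTo n (λ i → f i + g i) ≡ sumTo n f + sumTo n g
sumTo-+ zero    f g = refl
sumTo-+ (suc n) f g = begin
  sumTo n (λ i → f i + g i) + (f (suc n) + g (suc n))
    ≡⟨ cong (_+ (f (suc n) + g (suc n))) (sumTo-+ n f g) ⟩
  (sumTo n f + sumTo n g) + (f (suc n) + g (suc n))
    ≡⟨ solve 4 (λ a b c d → (a :+ b) :+ (c :+ d) := (a :+ c) :+ (b :+ d))
         refl (sumTo n f) (sumTo n g) (f (suc n)) (g (suc n)) ⟩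
  (sumTo n f + f (suc n)) + (sumTo n g + g (suc n)) ∎

sumTo-*ˡ : ∀ n (f : ℕ → ℚ) c → c * sumTo n f ≡ sumTo n (λ i → c * f i)
sumTo-*ˡ zero    f c = refl
sumTo-*ˡ (suc n) f c =
  trans (*-distribˡ-+ c (sumTo n f) (f (suc n))) (cong (_+ c * f (suc n)) (sumTo-*ˡ n f c))

sumTo-swap : ∀ n m (g : ℕ → ℕ → ℚ) →
  sumTo n (λ k → sumTo m (g k)) ≡ sumTo m (λ i → sumTo n (λ k → g k i))
sumTo-swap zero    m g = refl
sumTo-swap (suc n) m g = begin
  sumTo n (λ k → sumTo m (g k)) + sumTo m (g (suc n))
    ≡⟨ cong (_+ sumTo m (g (suc n))) (sumTo-swap n m g) ⟩
  sumTo m (λ i → sumTo n (λ k → g k i)) + sumTo m (g (suc n))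
    ≡⟨ sym (sumTo-+ m _ _) ⟩
  sumTo m (λ i → sumTo n (λ k → g k i) + g (suc n) i) ∎

sumTo-vanishing-tail : ∀ M d (f : ℕ → ℚ) → (∀ j → M < j → f j ≡ 0ℚ) →
  sumTo (d ℕ.+ M) f ≡ sumTo M f
sumTo-vanishing-tail M zero    f f>M≡0 = refl
sumTo-vanishing-tail M (suc d) f f>M≡0 = begin
  sumTo (d ℕ.+ M) f + f (suc (d ℕ.+ M))
    ≡⟨ cong₂ _+_ (sumTo-vanishing-tail M d f f>M≡0) (f>M≡0 _ (s≤s (ℕP.m≤n+m M d))) ⟩
  sumTo M f + 0ℚ
    ≡⟨ +-identityʳ _ ⟩
  sumTo M f ∎

binomial : ∀ N u v →
  sumTo N (λ k → ℕ→ℚ (N C k) * u ^ℚ k * v ^ℚ (N ∸ k)) ≡ (u + v) ^ℚ N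
binomial N u v = begin
  sumTo N (λ k → ℕ→ℚ (N C k) * u ^ℚ k * v ^ℚ (N ∸ k))
    ≡⟨ sumTo-is-∑ N _ ⟩
  sum {suc N} (λ k → ℕ→ℚ (N C toℕ k) * u ^ℚ toℕ k * v ^ℚ (N ∸ toℕ k))
    ≡⟨ sum-cong-≗ {suc N} (λ k → term (toℕ k)) ⟩
  binomialExpansion u v N
    ≡⟨ sym (binomialTheorem N u v) ⟩
  (u + v) ^ N
    ≡⟨ ^ℚ-is-^ (u + v) N ⟩
  (u + v) ^ℚ N ∎
  where
  term : ∀ k → ℕ→ℚ (N C k) * u ^ℚ k * v ^ℚ (N ∸ k) ≡ (N C k) × (u ^ k * v ^ (N ∸ k))
  term k = begin
    ℕ→ℚ (N C k) * u ^ℚ k * v ^ℚ (N ∸ k)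
      ≡⟨ solve 3 (λ c p q → c :* p :* q := c :* (p :* q)) refl (ℕ→ℚ (N C k)) (u ^ℚ k) (v ^ℚ (N ∸ k)) ⟩
    ℕ→ℚ (N C k) * (u ^ℚ k * v ^ℚ (N ∸ k))
      ≡⟨ sym (cong₂ (λ p q → ℕ→ℚ (N C k) * (p * q)) (^ℚ-is-^ u k) (^ℚ-is-^ v (N ∸ k))) ⟩
    ℕ→ℚ (N C k) * (u ^ k * v ^ (N ∸ k))
      ≡⟨ sym (×-is-ℕ→ℚ* (N C k) _) ⟩
    (N C k) × (u ^ k * v ^ (N ∸ k)) ∎

alternatingBinomial : ∀ N u v →
  sumTo N (λ k → sgn (N ∸ k) * ℕ→ℚ (N C k) * u ^ℚ k * v ^ℚ (N ∸ k)) ≡ (u - v) ^ℚ N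
alternatingBinomial N u v = trans (sumTo-cong N signIntoPower) (binomial N u (- v))
  where
  signIntoPower : ∀ k → k ≤ N →
    sgn (N ∸ k) * ℕ→ℚ (N C k) * u ^ℚ k * v ^ℚ (N ∸ k) ≡ ℕ→ℚ (N C k) * u ^ℚ k * (- v) ^ℚ (N ∸ k)
  signIntoPower k _ = begin
    sgn (N ∸ k) * ℕ→ℚ (N C k) * u ^ℚ k * v ^ℚ (N ∸ k)
      ≡⟨ solve 4 (λ s c p q → s :* c :* p :* q := c :* p :* (s :* q))
           refl (sgn (N ∸ k)) (ℕ→ℚ (N C k)) (u ^ℚ k) (v ^ℚ (N ∸ k)) ⟩
    ℕ→ℚ (N C k) * u ^ℚ k * (sgn (N ∸ k) * v ^ℚ (N ∸ k))
      ≡⟨ cong (ℕ→ℚ (N C k) * u ^ℚ k *_) (sym (neg-^ℚ v (N ∸ k))) ⟩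
    ℕ→ℚ (N C k) * u ^ℚ k * (- v) ^ℚ (N ∸ k) ∎

inverseEulerianKernel : ∀ n i x → i ≤ n →
  sumTo n (λ k → sgn (n ∸ i ∸ k) * ℕ→ℚ ((n ∸ i) C k) * (1ℚ + x) ^ℚ k * x ^ℚ (n ∸ k)) ≡ x ^ℚ i
inverseEulerianKernel n i x i≤n = begin
  sumTo n (λ k → coeff k * x ^ℚ (n ∸ k))
    ≡⟨ cong (λ l → sumTo l (λ k → coeff k * x ^ℚ (n ∸ k))) (sym i+N≡n) ⟩
  sumTo (i ℕ.+ N) (λ k → coeff k * x ^ℚ (n ∸ k))
    ≡⟨ sumTo-vanishing-tail N i _ beyondN ⟩
  sumTo N (λ k → coeff k * x ^ℚ (n ∸ k))
    ≡⟨ sumTo-cong N factorOut ⟩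
  sumTo N (λ k → x ^ℚ i * (coeff k * x ^ℚ (N ∸ k)))
    ≡⟨ sym (sumTo-*ˡ N _ (x ^ℚ i)) ⟩
  x ^ℚ i * sumTo N (λ k → coeff k * x ^ℚ (N ∸ k))
    ≡⟨ cong (x ^ℚ i *_) (alternatingBinomial N (1ℚ + x) x) ⟩
  x ^ℚ i * ((1ℚ + x) - x) ^ℚ N
    ≡⟨ cong (λ y → x ^ℚ i * y ^ℚ N) (solve 1 (λ x → (con 1ℚ :+ x) :+ (:- x) := con 1ℚ) refl x) ⟩
  x ^ℚ i * 1ℚ ^ℚ N
    ≡⟨ trans (cong (x ^ℚ i *_) (1^ℚ N)) (*-identityʳ (x ^ℚ i)) ⟩
  x ^ℚ i ∎
  where
  N : ℕ
  N = n ∸ i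
  i+N≡n : i ℕ.+ N ≡ n
  i+N≡n = ℕP.m+[n∸m]≡n i≤n
  coeff : ℕ → ℚ
  coeff k = sgn (N ∸ k) * ℕ→ℚ (N C k) * (1ℚ + x) ^ℚ k
  beyondN : ∀ k → N < k → coeff k * x ^ℚ (n ∸ k) ≡ 0ℚ
  beyondN k N<k = begin
    sgn (N ∸ k) * ℕ→ℚ (N C k) * (1ℚ + x) ^ℚ k * x ^ℚ (n ∸ k)
      ≡⟨ cong (λ b → sgn (N ∸ k) * ℕ→ℚ b * (1ℚ + x) ^ℚ k * x ^ℚ (n ∸ k)) (k>n⇒nCk≡0 N<k) ⟩
    sgn (N ∸ k) * 0ℚ * (1ℚ + x) ^ℚ k * x ^ℚ (n ∸ k)
      ≡⟨ solve 3 (λ s p q → s :* con 0ℚ :* p :* q := con 0ℚ)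
           refl (sgn (N ∸ k)) ((1ℚ + x) ^ℚ k) (x ^ℚ (n ∸ k)) ⟩
    0ℚ ∎
  factorOut : ∀ k → k ≤ N → coeff k * x ^ℚ (n ∸ k) ≡ x ^ℚ i * (coeff k * x ^ℚ (N ∸ k))
  factorOut k k≤N = begin
    coeff k * x ^ℚ (n ∸ k)
      ≡⟨ cong (λ e → coeff k * x ^ℚ e) (trans (cong (_∸ k) (sym i+N≡n)) (ℕP.+-∸-assoc i k≤N)) ⟩
    coeff k * x ^ℚ (i ℕ.+ (N ∸ k))
      ≡⟨ cong (coeff k *_) (^ℚ-+ x i (N ∸ k)) ⟩
    coeff k * (x ^ℚ i * x ^ℚ (N ∸ k))
      ≡⟨ solve 3 (λ c a b → c :* (a :* b) := a :* (c :* b)) refl (coeff k) (x ^ℚ i) (x ^ℚ (N ∸ k)) ⟩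
    x ^ℚ i * (coeff k * x ^ℚ (N ∸ k)) ∎

-- The k-th coordinate of the polynomial Σ_i c_i x^i (c₀, …, cₙ arbitrary) in the
-- basis (1+x)^k x^(n-k); for c_i = i! W_m(n,i) these are the Eulerian–Dowling numbers.
eulerianCoefficient : ℕ → (ℕ → ℚ) → ℕ → ℚ
eulerianCoefficient n c k = sumTo n (λ i → sgn (n ∸ i ∸ k) * ℕ→ℚ ((n ∸ i) C k) * c i)

eulerianExpansion : ∀ n (c : ℕ → ℚ) x →
  sumTo n (λ i → c i * x ^ℚ i) ≡
  sumTo n (λ k → eulerianCoefficient n c k * (1ℚ + x) ^ℚ k * x ^ℚ (n ∸ k))
eulerianExpansion n c x = sym (begin
  sumTo n (λ k → eulerianCoefficient n c k * P k * Q k)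
    ≡⟨ sumTo-cong n (λ k _ → distribute k) ⟩
  sumTo n (λ k → sumTo n (λ i → c i * kernel i k))
    ≡⟨ sumTo-swap n n (λ k i → c i * kernel i k) ⟩
  sumTo n (λ i → sumTo n (λ k → c i * kernel i k))
    ≡⟨ sumTo-cong n (λ i _ → sym (sumTo-*ˡ n (kernel i) (c i))) ⟩
  sumTo n (λ i → c i * sumTo n (kernel i))
    ≡⟨ sumTo-cong n (λ i i≤n → cong (c i *_) (inverseEulerianKernel n i x i≤n)) ⟩
  sumTo n (λ i → c i * x ^ℚ i) ∎)
  where
  P Q : ℕ → ℚ
  P k = (1ℚ + x) ^ℚ k
  Q k = x ^ℚ (n ∸ k)
  kernel : ℕ → ℕ → ℚ
  kernel i k = sgn (n ∸ i ∸ k) * ℕ→ℚ ((n ∸ i) C k) * P k * Q k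
  distribute : ∀ k → eulerianCoefficient n c k * P k * Q k ≡ sumTo n (λ i → c i * kernel i k)
  distribute k = begin
    eulerianCoefficient n c k * P k * Q k
      ≡⟨ solve 3 (λ e p q → e :* p :* q := (p :* q) :* e) refl (eulerianCoefficient n c k) (P k) (Q k) ⟩
    P k * Q k * eulerianCoefficient n c k
      ≡⟨ sumTo-*ˡ n _ (P k * Q k) ⟩
    sumTo n (λ i → P k * Q k * (sgn (n ∸ i ∸ k) * ℕ→ℚ ((n ∸ i) C k) * c i))
      ≡⟨ sumTo-cong n (λ i _ → solve 5 (λ p q s b d → p :* q :* (s :* b :* d) := d :* (s :* b :* p :* q))
                                 refl (P k) (Q k) (sgn (n ∸ i ∸ k)) (ℕ→ℚ ((n ∸ i) C k)) (c i)) ⟩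
    sumTo n (λ i → c i * kernel i k) ∎

mainTheorem10 : (m' n : ℕ) (x : ℚ) →
    F m' n x ≡ sumTo n (λ k → a m' n k * ((1ℚ + x) ^ℚ k) * (x ^ℚ (n ∸ k)))
mainTheorem10 m' n x = begin
  F m' n x
    ≡⟨ eulerianExpansion n c x ⟩
  sumTo n (λ k → eulerianCoefficient n c k * (1ℚ + x) ^ℚ k * x ^ℚ (n ∸ k))
    ≡⟨ sumTo-cong n (λ k _ → cong (λ e → e * (1ℚ + x) ^ℚ k * x ^ℚ (n ∸ k)) (coefficient≡a k)) ⟩
  sumTo n (λ k → a m' n k * (1ℚ + x) ^ℚ k * x ^ℚ (n ∸ k)) ∎
  where
  c : ℕ → ℚ
  c i = ℕ→ℚ (i ℕ.!) * W m' n i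
  coefficient≡a : ∀ k → eulerianCoefficient n c k ≡ a m' n k
  coefficient≡a k = sumTo-cong n (λ i _ →
    solve 4 (λ s b f w → s :* b :* (f :* w) := s :* f :* b :* w)
      refl (sgn (n ∸ i ∸ k)) (ℕ→ℚ ((n ∸ i) C k)) (ℕ→ℚ (i ℕ.!)) (W m' n i))
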